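{- Let $\mathbb{F}_2((x))$ be the field of formal Laurent series over $\mathbb{F}_2$, and take a sequence $\{x^{1/n}\}_{n\in\mathbb{Z}_{>0}}$ of elements of an algebraic closure of $\mathbb{F}_2((x))$ such that $x^{1/1}=x$ and $(x^{1/mn})^m=x^{1/n}$ for all $m,n\in\mathbb{Z}_{>0}$. Let $R:=\bigcup_{n=1}^{\infty}\mathbb{F}_2[[x^{1/n}]]$. Then the unit group \[R^{\times}=\bigcup_{n=1}^{\infty}\mathbb{F}_2[[x^{1/n}]]^{\times}\] is a linear space over $\mathbb{Q}$.
   Context: An abelian group $G$ (written multiplicatively) is said to be a linear space over a field $K$ if there is a scalar multiplication $K\times G\to G$ making $G$, with its group operation as vector addition, a vector space over $K$. Here $\mathbb{F}_2[[x^{1/n}]]$ denotes the formal power series ring over $\mathbb{F}_2$ in $x^{1/n}$. -}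

module Defs where

open import Data.Bool using (Bool; true; false; _xor_; _∧_; if_then_else_)
open import Data.Nat using (ℕ; zero; suc; _*_; _∸_; _/_)
open import Data.Nat.Divisibility using (_∣?_)
open import Data.Product using (Σ; _×_; _,_)
open import Relation.Nullary.Decidable using (⌊_⌋)
open import Relation.Binary.PropositionalEquality using (_≡_)
open import Data.Rational using (ℚ; 1ℚ) renaming (_+_ to _ℚ+_; _*_ to _ℚ*_)

-- Formal power series over 𝔽₂ = Bool (xor = +, ∧ = ·) in one variable t,
-- given by their coefficient sequence: f k = coefficient of t^k.
Series : Set
Series = ℕ → Bool

sumUpTo : (ℕ → Bool) → ℕ → Bool
sumUpTo g zero    = g zero
sumUpTo g (suc k) = sumUpTo g k xor g (suc k)

_⊛_ : Series → Series → Series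
(f ⊛ g) k = sumUpTo (λ i → f i ∧ g (k ∸ i)) k

-- Substitution t ↦ t^m  (m = suc m'):  coefficients spread out by factor m.
spread : ℕ → Series → Series
spread m' f j = if ⌊ suc m' ∣? j ⌋ then f (j / suc m') else false

-- An element of R = ⋃_n 𝔽₂[[x^{1/n}]] is represented by a level n = suc d
-- and a series f ∈ 𝔽₂[[x^{1/(suc d)}]], standing for Σ_k f k · x^{k/(suc d)}.
-- (With the compatible system x^{1/n}, 𝔽₂[[x^{1/n}]] ⊆ 𝔽₂[[x^{1/mn}]] via
--  x^{1/n} = (x^{1/mn})^m, i.e. via `spread`.)
record R : Set where
  constructor ⟨_,_⟩
  field
    den-1 : ℕ
    ser   : Series
open R public

-- equality in R: compare in the common ring 𝔽₂[[x^{1/(n m)}]]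
_≈R_ : R → R → Set
⟨ d , f ⟩ ≈R ⟨ e , g ⟩ = ∀ j → spread e f j ≡ spread d g j

-- multiplication in R (levels suc d, suc e ⊆ level (suc d)(suc e))
_·R_ : R → R → R
⟨ d , f ⟩ ·R ⟨ e , g ⟩ = ⟨ suc d * suc e ∸ 1 , spread e f ⊛ spread d g ⟩

oneSeries : Series
oneSeries zero    = true
oneSeries (suc _) = false

1R : R
1R = ⟨ 0 , oneSeries ⟩

IsUnitR : R → Set
IsUnitR u = Σ R λ v → ((u ·R v) ≈R 1R) × ((v ·R u) ≈R 1R)

IsUnitAtLevel : ℕ → Series → Set
IsUnitAtLevel d f = Σ Series λ g → ((f ⊛ g) k≡ oneSeries) × ((g ⊛ f) k≡ oneSeries)
  where
  _k≡_ : Series → Series → Set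
  a k≡ b = ∀ k → a k ≡ b k

-- "The unit group R^× (with multiplication of R as vector addition) is a
-- linear space over ℚ": there is a scalar multiplication _•_ : ℚ × R^× → R^×
-- satisfying the vector space axioms.  _•_ is given as a function ℚ → R → R
-- whose restriction to units lands in the units; all axioms are only required
-- on units.  (ℚ is stdlib's normalised ℚ, so its equality is _≡_.)
record IsLinearSpaceOverℚ (_•_ : ℚ → R → R) : Set where
  field
    •-closed : ∀ q u → IsUnitR u → IsUnitR (q • u)
    •-cong   : ∀ q u v → IsUnitR u → IsUnitR v → u ≈R v → (q • u) ≈R (q • v)
    •-one    : ∀ u → IsUnitR u → (1ℚ • u) ≈R u
    •-assoc  : ∀ p q u → IsUnitR u → ((p ℚ* q) • u) ≈R (p • (q • u))
    •-distribʳ : ∀ p q u → IsUnitR u → ((p ℚ+ q) • u) ≈R ((p • u) ·R (q • u))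
    •-distribˡ : ∀ p u v → IsUnitR u → IsUnitR v → (p • (u ·R v)) ≈R ((p • u) ·R (p • v))

UnitGroupIsLinearSpaceOverℚ : Set
UnitGroupIsLinearSpaceOverℚ = Σ (ℚ → R → R) IsLinearSpaceOverℚ

-- An element of R is a unit iff its constant term is 1: at a fixed level its inverse is built
-- coefficient by coefficient. In the unit group every element has a unique n-th root for
-- each n ≥ 1. For n = 2 this is Frobenius: f² is f with x^{1/m} replaced by x^{2/m}, so the
-- square root of f is f itself read at level 2m. For odd n, changing the coefficient of
-- degree k+1 of g changes that of gⁿ by n ≡ 1 (mod 2) and leaves lower ones alone, so gⁿ = f
-- is again solved coefficient by coefficient, uniquely. A uniquely divisible abelian group is
-- a ℚ-vector space, with (n/d)·u the unique d-th root of uⁿ.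

module Submission where

open import Defs
open import Algebra.Bundles using (AbelianGroup; CommutativeRing)
open import Data.Bool using (Bool; true; false; not; _∧_; _xor_)
import Data.Bool as Bool
open import Data.Bool.Properties
  using ( ¬-not; not-¬; ∧-idem; ∧-conicalˡ; not-involutive; xor-assoc; xor-comm; xor-same; xor-identityʳ
        ; ∧-comm; ∧-assoc; ∧-zeroʳ; ∧-distribˡ-xor; ∧-distribʳ-xor; xor-∧-commutativeRing)
open import Data.Integer as ℤ using (ℤ; +_; -[1+_]; _⊖_)
import Data.Integer.Properties as ℤ
open import Data.Nat using (ℕ; zero; suc; _+_; _*_; _∸_; _/_; _≤_; _<_; z≤n; s≤s)
open import Data.Nat.Divisibility using (_∣_; divides; _∣?_; n∣m*n; ∣m+n∣m⇒∣n; ∣m∣n⇒∣m+n; ∣⇒≤)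
open import Data.Nat.DivMod using (m*n/n≡m)
open import Data.Nat.Induction using (<-rec)
open import Data.Nat.Properties
open import Data.Product using (Σ; _×_; _,_; proj₁; proj₂)
open import Data.Rational as ℚ using (ℚ; ↥_; ↧_; 1ℚ)
import Data.Rational.Properties as ℚ
import Data.Rational.Unnormalised.Properties as ℚᵘ
open import Data.Sum using (_⊎_; inj₁; inj₂)
open import Function.Base using (_∘_)
open import Function.Construct.Composition using (_⇔-∘_)
open import Function.Construct.Symmetry using (⇔-sym)
open import Function.Bundles using (_⇔_; mk⇔; module Equivalence)
open import Level using (0ℓ; _⊔_)
open import Relation.Binary.Bundles using (Setoid)
open import Relation.Binary.PropositionalEquality
  using (_≡_; _≗_; refl; sym; trans; cong; cong₂; subst; subst₂; module ≡-Reasoning)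
import Relation.Binary.Reasoning.Setoid as SetoidReasoning
open import Relation.Nullary using (¬_; does; yes; no; contradiction)
open import Relation.Nullary.Decidable using (dec-true; dec-false)
open import Algebra.Properties.CommutativeSemigroup
  (CommutativeRing.+-commutativeSemigroup xor-∧-commutativeRing) using () renaming (interchange to xor-interchange)

twice : ℕ → ℕ
twice zero    = zero
twice (suc n) = suc (suc (twice n))

data EvenOdd : ℕ → Set where
  even : ∀ n → EvenOdd (twice n)
  odd  : ∀ n → EvenOdd (suc (twice n))

evenOdd : ∀ j → EvenOdd j
evenOdd zero = even zero
evenOdd (suc j) with evenOdd j
... | even n = odd n
... | odd  n = even (suc n)

twice≡+ : ∀ n → twice n ≡ n + n
twice≡+ zero    = refl
twice≡+ (suc n) = cong suc (trans (cong suc (twice≡+ n)) (sym (+-suc n n)))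

twice≡*2 : ∀ n → twice n ≡ n * 2
twice≡*2 n = trans (twice≡+ n) (trans (cong (λ k → n + k) (sym (+-identityʳ n))) (*-comm 2 n))

n≤twice-n : ∀ n → n ≤ twice n
n≤twice-n n = subst (n ≤_) (sym (twice≡+ n)) (m≤m+n n n)

isOdd : ℕ → Bool
isOdd zero    = false
isOdd (suc n) = not (isOdd n)

isOdd-1+twice : ∀ n → isOdd (suc (twice n)) ≡ true
isOdd-1+twice zero    = refl
isOdd-1+twice (suc n) = trans (not-involutive _) (isOdd-1+twice n)

↥↧-* : ∀ p q → ↥ (p ℚ.* q) ℤ.* (↧ p ℤ.* ↧ q) ≡ (↥ p ℤ.* ↥ q) ℤ.* ↧ (p ℚ.* q)
↥↧-* p@record{} q@record{} =
  subst₂ (λ a b → a ℤ.* (↧ p ℤ.* ↧ q) ≡ (↥ p ℤ.* ↥ q) ℤ.* b)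
    (ℚ.↥ᵘ-toℚᵘ (p ℚ.* q)) (ℚ.↧ᵘ-toℚᵘ (p ℚ.* q)) (ℚᵘ.drop-*≡* (ℚ.toℚᵘ-homo-* p q))

↥↧-+ : ∀ p q →
  ↥ (p ℚ.+ q) ℤ.* (↧ p ℤ.* ↧ q) ≡ (↥ p ℤ.* ↧ q ℤ.+ ↥ q ℤ.* ↧ p) ℤ.* ↧ (p ℚ.+ q)
↥↧-+ p@record{} q@record{} =
  subst₂ (λ a b → a ℤ.* (↧ p ℤ.* ↧ q) ≡ (↥ p ℤ.* ↧ q ℤ.+ ↥ q ℤ.* ↧ p) ℤ.* b)
    (ℚ.↥ᵘ-toℚᵘ (p ℚ.+ q)) (ℚ.↧ᵘ-toℚᵘ (p ℚ.+ q)) (ℚᵘ.drop-*≡* (ℚ.toℚᵘ-homo-+ p q))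

-- Uniquely divisible abelian groups

module DivisibleAbelianGroup {a ℓ} (G : AbelianGroup a ℓ) where

  open AbelianGroup G renaming (refl to ≈-refl; sym to ≈-sym; trans to ≈-trans)
  open import Algebra.Definitions.RawMonoid rawMonoid using () renaming (_×_ to _times_)
  open import Algebra.Properties.Monoid.Mult monoid using (×-congʳ; ×-congˡ; ×-homo-+; ×-assocˡ)
  open import Algebra.Properties.CommutativeMonoid.Mult commutativeMonoid using (×-distrib-+)
  open import Algebra.Properties.Group group using (ε⁻¹≈ε; ⁻¹-involutive)
  open import Algebra.Properties.AbelianGroup G using (⁻¹-∙-comm)
  open import Algebra.Properties.CommutativeSemigroup commutativeSemigroup using (interchange)
  open import Relation.Binary.Reasoning.Setoid setoid

  infixr 8 _^_

  _^_ : Carrier → ℕ → Carrier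
  x ^ n = n times x

  HasRoots : ℕ → Set (a ⊔ ℓ)
  HasRoots n = ∀ y → Σ Carrier λ x → x ^ n ≈ y

  PowInjective : ℕ → Set (a ⊔ ℓ)
  PowInjective n = ∀ x y → x ^ n ≈ y ^ n → x ≈ y

  ^-* : ∀ x m n → x ^ (m * n) ≈ (x ^ m) ^ n
  ^-* x m n = ≈-sym (≈-trans (×-assocˡ x n m) (×-congˡ (*-comm n m)))

  hasRoots-* : ∀ {m n} → HasRoots m → HasRoots n → HasRoots (m * n)
  hasRoots-* {m} {n} roots-m roots-n y with roots-m y
  ... | z , z^m≈y with roots-n z
  ...   | x , x^n≈z = x , (begin
    x ^ (m * n)  ≈⟨ ×-assocˡ x m n ⟨
    (x ^ n) ^ m  ≈⟨ ×-congʳ m x^n≈z ⟩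
    z ^ m        ≈⟨ z^m≈y ⟩
    y            ∎)

  powInjective-* : ∀ {m n} → PowInjective m → PowInjective n → PowInjective (m * n)
  powInjective-* {m} {n} inj-m inj-n x y x^mn≈y^mn = inj-n x y (inj-m (x ^ n) (y ^ n) (begin
    (x ^ n) ^ m  ≈⟨ ×-assocˡ x m n ⟩
    x ^ (m * n)  ≈⟨ x^mn≈y^mn ⟩
    y ^ (m * n)  ≈⟨ ×-assocˡ y m n ⟨
    (y ^ n) ^ m  ∎))

  UniquelyDivisibleBy : ℕ → Set (a ⊔ ℓ)
  UniquelyDivisibleBy n = HasRoots n × PowInjective n

  uniquelyDivisible : UniquelyDivisibleBy 2 → (∀ n → UniquelyDivisibleBy (suc (twice n))) →
                      ∀ n → UniquelyDivisibleBy (suc n)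
  uniquelyDivisible (roots-2 , inj-2) odd-divisible = <-rec (UniquelyDivisibleBy ∘ suc) step
    where
    step : ∀ n → (∀ {m} → m < n → UniquelyDivisibleBy (suc m)) → UniquelyDivisibleBy (suc n)
    step n smaller with evenOdd n
    ... | even m = odd-divisible m
    ... | odd  m with smaller (s≤s (n≤twice-n m))
    ...   | roots-m , inj-m = subst UniquelyDivisibleBy (sym (twice≡*2 (suc m)))
                                (hasRoots-* {suc m} {2} roots-m roots-2 , powInjective-* {suc m} {2} inj-m inj-2)

  infixr 8 _^ℤ_
  _^ℤ_ : Carrier → ℤ → Carrier
  x ^ℤ (+ n)    = x ^ n
  x ^ℤ -[1+ n ] = (x ^ suc n) ⁻¹

  ^ℤ-congˡ : ∀ {x y} i → x ≈ y → x ^ℤ i ≈ y ^ℤ i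
  ^ℤ-congˡ (+ n)    x≈y = ×-congʳ n x≈y
  ^ℤ-congˡ -[1+ n ] x≈y = ⁻¹-cong (×-congʳ (suc n) x≈y)

  ^ℤ-⊖ : ∀ x m n → x ^ℤ (m ⊖ n) ≈ x ^ m ∙ (x ^ n) ⁻¹
  ^ℤ-⊖ x m       zero    = begin
    x ^ m           ≈⟨ identityʳ (x ^ m) ⟨
    x ^ m ∙ ε       ≈⟨ ∙-congˡ ε⁻¹≈ε ⟨
    x ^ m ∙ ε ⁻¹    ∎
  ^ℤ-⊖ x zero    (suc n) = ≈-sym (identityˡ _)
  ^ℤ-⊖ x (suc m) (suc n) = begin
    x ^ℤ (suc m ⊖ suc n)                ≡⟨ cong (x ^ℤ_) (ℤ.[1+m]⊖[1+n]≡m⊖n m n) ⟩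
    x ^ℤ (m ⊖ n)                        ≈⟨ ^ℤ-⊖ x m n ⟩
    x ^ m ∙ (x ^ n) ⁻¹                  ≈⟨ identityˡ _ ⟨
    ε ∙ (x ^ m ∙ (x ^ n) ⁻¹)            ≈⟨ ∙-congʳ (inverseʳ x) ⟨
    (x ∙ x ⁻¹) ∙ (x ^ m ∙ (x ^ n) ⁻¹)   ≈⟨ interchange x (x ⁻¹) (x ^ m) ((x ^ n) ⁻¹) ⟩
    (x ∙ x ^ m) ∙ (x ⁻¹ ∙ (x ^ n) ⁻¹)   ≈⟨ ∙-congˡ (⁻¹-∙-comm x (x ^ n)) ⟩
    x ^ suc m ∙ (x ^ suc n) ⁻¹          ∎

  ^ℤ-+ : ∀ x i j → x ^ℤ (i ℤ.+ j) ≈ x ^ℤ i ∙ x ^ℤ j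
  ^ℤ-+ x (+ m)    (+ n)    = ×-homo-+ x m n
  ^ℤ-+ x (+ m)    -[1+ n ] = ^ℤ-⊖ x m (suc n)
  ^ℤ-+ x -[1+ m ] (+ n)    = ≈-trans (^ℤ-⊖ x n (suc m)) (comm _ _)
  ^ℤ-+ x -[1+ m ] -[1+ n ] = begin
    (x ^ suc (suc (m + n))) ⁻¹        ≡⟨ cong (λ k → (x ^ suc k) ⁻¹) (+-suc m n) ⟨
    (x ^ (suc m + suc n)) ⁻¹          ≈⟨ ⁻¹-cong (×-homo-+ x (suc m) (suc n)) ⟩
    (x ^ suc m ∙ x ^ suc n) ⁻¹        ≈⟨ ⁻¹-∙-comm (x ^ suc m) (x ^ suc n) ⟨
    (x ^ suc m) ⁻¹ ∙ (x ^ suc n) ⁻¹   ∎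

  ^ℤ-neg : ∀ x i → x ^ℤ (ℤ.- i) ≈ (x ^ℤ i) ⁻¹
  ^ℤ-neg x (+ zero)  = ≈-sym ε⁻¹≈ε
  ^ℤ-neg x (+ suc n) = ≈-refl
  ^ℤ-neg x -[1+ n ]  = ≈-sym (⁻¹-involutive _)

  ^ℤ-*-+ : ∀ x i n → x ^ℤ (i ℤ.* + n) ≈ (x ^ℤ i) ^ n
  ^ℤ-*-+ x i zero    = reflexive (cong (x ^ℤ_) (ℤ.*-zeroʳ i))
  ^ℤ-*-+ x i (suc n) = begin
    x ^ℤ (i ℤ.* + suc n)          ≡⟨ cong (x ^ℤ_) (ℤ.*-suc i (+ n)) ⟩
    x ^ℤ (i ℤ.+ i ℤ.* + n)        ≈⟨ ^ℤ-+ x i (i ℤ.* + n) ⟩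
    x ^ℤ i ∙ x ^ℤ (i ℤ.* + n)     ≈⟨ ∙-congˡ (^ℤ-*-+ x i n) ⟩
    x ^ℤ i ∙ (x ^ℤ i) ^ n         ∎

  ^ℤ-* : ∀ x i j → x ^ℤ (i ℤ.* j) ≈ (x ^ℤ i) ^ℤ j
  ^ℤ-* x i (+ n)    = ^ℤ-*-+ x i n
  ^ℤ-* x i -[1+ n ] = begin
    x ^ℤ (i ℤ.* -[1+ n ])           ≡⟨ cong (x ^ℤ_) (ℤ.neg-distribʳ-* i (+ suc n)) ⟨
    x ^ℤ (ℤ.- (i ℤ.* + suc n))      ≈⟨ ^ℤ-neg x (i ℤ.* + suc n) ⟩
    (x ^ℤ (i ℤ.* + suc n)) ⁻¹       ≈⟨ ⁻¹-cong (^ℤ-*-+ x i (suc n)) ⟩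
    ((x ^ℤ i) ^ suc n) ⁻¹           ∎

  ^ℤ-^-comm : ∀ x i n → (x ^ℤ i) ^ n ≈ (x ^ n) ^ℤ i
  ^ℤ-^-comm x i n = begin
    (x ^ℤ i) ^ n          ≈⟨ ^ℤ-*-+ x i n ⟨
    x ^ℤ (i ℤ.* + n)      ≡⟨ cong (x ^ℤ_) (ℤ.*-comm i (+ n)) ⟩
    x ^ℤ (+ n ℤ.* i)      ≈⟨ ^ℤ-* x (+ n) i ⟩
    (x ^ n) ^ℤ i          ∎

  ^ℤ-distrib : ∀ x y i → (x ∙ y) ^ℤ i ≈ x ^ℤ i ∙ y ^ℤ i
  ^ℤ-distrib x y (+ n)    = ×-distrib-+ x y n
  ^ℤ-distrib x y -[1+ n ] = ≈-trans (⁻¹-cong (×-distrib-+ x y (suc n))) (≈-sym (⁻¹-∙-comm _ _))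

  module ScalarAction (divisible : ∀ n → UniquelyDivisibleBy (suc n)) where

    root : ℕ → Carrier → Carrier
    root n y = proj₁ (proj₁ (divisible n) y)

    root-spec : ∀ n y → root n y ^ suc n ≈ y
    root-spec n y = proj₂ (proj₁ (divisible n) y)

    ^-injective : ∀ n {x y} → x ^ suc n ≈ y ^ suc n → x ≈ y
    ^-injective n {x} {y} = proj₂ (divisible n) x y

    -- Both x and y are the (d + 1)(d′ + 1)-th root of z ^ (n (d′ + 1)).
    root-unique : ∀ {x y z} d d′ n n′ → x ^ suc d ≈ z ^ℤ n → y ^ suc d′ ≈ z ^ℤ n′ →
                  n ℤ.* + suc d′ ≡ n′ ℤ.* + suc d → x ≈ y
    root-unique {x} {y} {z} d d′ n n′ x^d≈z^n y^d′≈z^n′ n/d≡n′/d′ = ^-injective (d + d′ * suc d) (begin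
      x ^ (suc d′ * suc d)           ≈⟨ ×-assocˡ x (suc d′) (suc d) ⟨
      (x ^ suc d) ^ suc d′           ≈⟨ ×-congʳ (suc d′) x^d≈z^n ⟩
      (z ^ℤ n) ^ suc d′              ≈⟨ ^ℤ-*-+ z n (suc d′) ⟨
      z ^ℤ (n ℤ.* + suc d′)          ≡⟨ cong (z ^ℤ_) n/d≡n′/d′ ⟩
      z ^ℤ (n′ ℤ.* + suc d)          ≈⟨ ^ℤ-*-+ z n′ (suc d) ⟩
      (z ^ℤ n′) ^ suc d              ≈⟨ ×-congʳ (suc d) y^d′≈z^n′ ⟨
      (y ^ suc d′) ^ suc d           ≈⟨ ×-assocˡ y (suc d) (suc d′) ⟩
      y ^ (suc d * suc d′)           ≡⟨ cong (y ^_) (*-comm (suc d) (suc d′)) ⟩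
      y ^ (suc d′ * suc d)           ∎)

    infixr 8 _•_
    _•_ : ℚ → Carrier → Carrier
    q • x = root (ℚ.denominator-1 q) (x ^ℤ ↥ q)

    •-spec : ∀ q x → (q • x) ^ suc (ℚ.denominator-1 q) ≈ x ^ℤ ↥ q
    •-spec q x = root-spec (ℚ.denominator-1 q) (x ^ℤ ↥ q)

    •-cong : ∀ q {x y} → x ≈ y → q • x ≈ q • y
    •-cong q {x} {y} x≈y = root-unique d d (↥ q) (↥ q) (•-spec q x)
      (≈-trans (•-spec q y) (^ℤ-congˡ (↥ q) (≈-sym x≈y))) refl
      where d = ℚ.denominator-1 q

    •-identity : ∀ x → 1ℚ • x ≈ x
    •-identity x = root-unique 0 0 (+ 1) (+ 1) (•-spec 1ℚ x) ≈-refl refl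

    •-distribˡ : ∀ q x y → q • (x ∙ y) ≈ q • x ∙ q • y
    •-distribˡ q x y = root-unique d d (↥ q) (↥ q) (•-spec q (x ∙ y)) (begin
      (q • x ∙ q • y) ^ suc d                 ≈⟨ ×-distrib-+ (q • x) (q • y) (suc d) ⟩
      (q • x) ^ suc d ∙ (q • y) ^ suc d       ≈⟨ ∙-cong (•-spec q x) (•-spec q y) ⟩
      x ^ℤ ↥ q ∙ y ^ℤ ↥ q                     ≈⟨ ^ℤ-distrib x y (↥ q) ⟨
      (x ∙ y) ^ℤ ↥ q                          ∎) refl
      where d = ℚ.denominator-1 q

    •-assoc : ∀ p q x → (p ℚ.* q) • x ≈ p • q • x
    •-assoc p q x = root-unique (ℚ.denominator-1 (p ℚ.* q)) (dq + dp * suc dq) (↥ (p ℚ.* q)) (↥ q ℤ.* ↥ p)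
      (•-spec (p ℚ.* q) x) (begin
        (p • q • x) ^ (suc dp * suc dq)    ≈⟨ ^-* (p • q • x) (suc dp) (suc dq) ⟩
        ((p • q • x) ^ suc dp) ^ suc dq    ≈⟨ ×-congʳ (suc dq) (•-spec p (q • x)) ⟩
        ((q • x) ^ℤ ↥ p) ^ suc dq          ≈⟨ ^ℤ-^-comm (q • x) (↥ p) (suc dq) ⟩
        ((q • x) ^ suc dq) ^ℤ ↥ p          ≈⟨ ^ℤ-congˡ (↥ p) (•-spec q x) ⟩
        (x ^ℤ ↥ q) ^ℤ ↥ p                  ≈⟨ ^ℤ-* x (↥ q) (↥ p) ⟨
        x ^ℤ (↥ q ℤ.* ↥ p)                 ∎)
      (trans (↥↧-* p q) (cong (ℤ._* ↧ (p ℚ.* q)) (ℤ.*-comm (↥ p) (↥ q))))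
      where
      dp = ℚ.denominator-1 p
      dq = ℚ.denominator-1 q

    •-distribʳ : ∀ p q x → (p ℚ.+ q) • x ≈ p • x ∙ q • x
    •-distribʳ p q x = root-unique (ℚ.denominator-1 (p ℚ.+ q)) (dq + dp * suc dq) (↥ (p ℚ.+ q))
      (↥ p ℤ.* ↧ q ℤ.+ ↥ q ℤ.* ↧ p) (•-spec (p ℚ.+ q) x) (begin
        (p • x ∙ q • x) ^ (suc dp * suc dq)
          ≈⟨ ×-distrib-+ (p • x) (q • x) (suc dp * suc dq) ⟩
        (p • x) ^ (suc dp * suc dq) ∙ (q • x) ^ (suc dp * suc dq)
          ≡⟨ cong (λ n → (p • x) ^ (suc dp * suc dq) ∙ (q • x) ^ n) (*-comm (suc dp) (suc dq)) ⟩
        (p • x) ^ (suc dp * suc dq) ∙ (q • x) ^ (suc dq * suc dp)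
          ≈⟨ ∙-cong (^-* (p • x) (suc dp) (suc dq)) (^-* (q • x) (suc dq) (suc dp)) ⟩
        ((p • x) ^ suc dp) ^ suc dq ∙ ((q • x) ^ suc dq) ^ suc dp
          ≈⟨ ∙-cong (×-congʳ (suc dq) (•-spec p x)) (×-congʳ (suc dp) (•-spec q x)) ⟩
        (x ^ℤ ↥ p) ^ suc dq ∙ (x ^ℤ ↥ q) ^ suc dp
          ≈⟨ ∙-cong (^ℤ-*-+ x (↥ p) (suc dq)) (^ℤ-*-+ x (↥ q) (suc dp)) ⟨
        x ^ℤ (↥ p ℤ.* ↧ q) ∙ x ^ℤ (↥ q ℤ.* ↧ p)
          ≈⟨ ^ℤ-+ x (↥ p ℤ.* ↧ q) (↥ q ℤ.* ↧ p) ⟨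
        x ^ℤ (↥ p ℤ.* ↧ q ℤ.+ ↥ q ℤ.* ↧ p) ∎)
      (↥↧-+ p q)
      where
      dp = ℚ.denominator-1 p
      dq = ℚ.denominator-1 q

xor-cancelˡ : ∀ x y → x xor (x xor y) ≡ y
xor-cancelˡ x y = trans (sym (xor-assoc x x y)) (cong (_xor y) (xor-same x))

xor≡true⇒≡not : ∀ x y → x xor y ≡ true → y ≡ not x
xor≡true⇒≡not x y x⊕y≡true = begin
  y                ≡⟨ xor-cancelˡ x y ⟨
  x xor (x xor y)  ≡⟨ cong (x xor_) x⊕y≡true ⟩
  x xor true       ≡⟨ xor-comm x true ⟩
  not x            ∎
  where open ≡-Reasoning

sumUpTo-cong : ∀ {g h : ℕ → Bool} k → (∀ i → i ≤ k → g i ≡ h i) → sumUpTo g k ≡ sumUpTo h k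
sumUpTo-cong zero    g≡h = g≡h 0 z≤n
sumUpTo-cong (suc k) g≡h = cong₂ _xor_ (sumUpTo-cong k (λ i i≤k → g≡h i (m≤n⇒m≤1+n i≤k))) (g≡h (suc k) ≤-refl)

sumUpTo-xor : ∀ (g h : ℕ → Bool) k → sumUpTo (λ i → g i xor h i) k ≡ sumUpTo g k xor sumUpTo h k
sumUpTo-xor g h zero    = refl
sumUpTo-xor g h (suc k) = trans (cong (_xor (g (suc k) xor h (suc k))) (sumUpTo-xor g h k))
                                (xor-interchange (sumUpTo g k) (sumUpTo h k) (g (suc k)) (h (suc k)))

sumUpTo-∧ˡ : ∀ c (g : ℕ → Bool) k → sumUpTo (λ i → c ∧ g i) k ≡ c ∧ sumUpTo g k
sumUpTo-∧ˡ c g zero    = refl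
sumUpTo-∧ˡ c g (suc k) = trans (cong (_xor (c ∧ g (suc k))) (sumUpTo-∧ˡ c g k)) (sym (∧-distribˡ-xor c _ _))

sumUpTo-∧ʳ : ∀ c (g : ℕ → Bool) k → sumUpTo (λ i → g i ∧ c) k ≡ sumUpTo g k ∧ c
sumUpTo-∧ʳ c g zero    = refl
sumUpTo-∧ʳ c g (suc k) =
  trans (cong (_xor (g (suc k) ∧ c)) (sumUpTo-∧ʳ c g k)) (sym (∧-distribʳ-xor c (sumUpTo g k) (g (suc k))))

sumUpTo-false : ∀ (g : ℕ → Bool) k → (∀ i → i ≤ k → g i ≡ false) → sumUpTo g k ≡ false
sumUpTo-false g k g≡false = trans (sumUpTo-cong k g≡false) (sumUpTo-const-false k)
  where
  sumUpTo-const-false : ∀ k → sumUpTo (λ _ → false) k ≡ false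
  sumUpTo-const-false zero    = refl
  sumUpTo-const-false (suc k) = cong (_xor false) (sumUpTo-const-false k)

sumUpTo-suc : ∀ (g : ℕ → Bool) k → sumUpTo g (suc k) ≡ g 0 xor sumUpTo (g ∘ suc) k
sumUpTo-suc g zero    = refl
sumUpTo-suc g (suc k) = trans (cong (_xor g (suc (suc k))) (sumUpTo-suc g k)) (xor-assoc (g 0) _ _)

sumUpTo-reverse : ∀ (g : ℕ → Bool) k → sumUpTo g k ≡ sumUpTo (λ i → g (k ∸ i)) k
sumUpTo-reverse g zero    = refl
sumUpTo-reverse g (suc k) = sym (begin
  sumUpTo (λ i → g (suc k ∸ i)) (suc k)     ≡⟨ sumUpTo-suc (λ i → g (suc k ∸ i)) k ⟩
  g (suc k) xor sumUpTo (λ i → g (k ∸ i)) k ≡⟨ cong (g (suc k) xor_) (sumUpTo-reverse g k) ⟨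
  g (suc k) xor sumUpTo g k                 ≡⟨ xor-comm (g (suc k)) _ ⟩
  sumUpTo g (suc k)                         ∎)
  where open ≡-Reasoning

sumUpTo-triangle : ∀ (H : ℕ → ℕ → Bool) k →
  sumUpTo (λ i → sumUpTo (H i) i) k ≡ sumUpTo (λ j → sumUpTo (λ l → H (j + l) j) (k ∸ j)) k
sumUpTo-triangle H zero    = refl
sumUpTo-triangle H (suc k) = begin
  sumUpTo (λ i → sumUpTo (H i) i) k xor sumUpTo (H (suc k)) (suc k)
    ≡⟨ cong (_xor sumUpTo (H (suc k)) (suc k)) (sumUpTo-triangle H k) ⟩
  sumUpTo Column k xor (sumUpTo (H (suc k)) k xor H (suc k) (suc k))
    ≡⟨ xor-assoc (sumUpTo Column k) _ _ ⟨
  (sumUpTo Column k xor sumUpTo (H (suc k)) k) xor H (suc k) (suc k)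
    ≡⟨ cong₂ _xor_ (sym (trans (sumUpTo-cong k extend) (sumUpTo-xor _ _ k))) (cong₂ H (sym (+-identityʳ (suc k))) refl) ⟩
  sumUpTo Column′ k xor H (suc k + 0) (suc k)
    ≡⟨ cong (λ n → sumUpTo Column′ k xor sumUpTo (λ l → H (suc k + l) (suc k)) n) (n∸n≡0 k) ⟨
  sumUpTo Column′ (suc k) ∎
  where
  open ≡-Reasoning
  Column Column′ : ℕ → Bool
  Column  j = sumUpTo (λ l → H (j + l) j) (k ∸ j)
  Column′ j = sumUpTo (λ l → H (j + l) j) (suc k ∸ j)
  extend : ∀ j → j ≤ k → Column′ j ≡ Column j xor H (suc k) j
  extend j j≤k rewrite +-∸-assoc 1 j≤k =
    cong (λ n → Column j xor H n j) (trans (+-suc j (k ∸ j)) (cong suc (m+[n∸m]≡n j≤k)))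

sumUpTo-extend-false : ∀ (H : ℕ → Bool) n r → (∀ t → t < r → H (n + suc t) ≡ false) →
  sumUpTo H (n + r) ≡ sumUpTo H n
sumUpTo-extend-false H n zero    _      = cong (sumUpTo H) (+-identityʳ n)
sumUpTo-extend-false H n (suc r) H≡false = begin
  sumUpTo H (n + suc r)                 ≡⟨ cong (sumUpTo H) (+-suc n r) ⟩
  sumUpTo H (n + r) xor H (suc (n + r)) ≡⟨ cong₂ _xor_ (sumUpTo-extend-false H n r (λ t t<r → H≡false t (m<n⇒m<1+n t<r)))
                                                        (trans (cong H (sym (+-suc n r))) (H≡false r ≤-refl)) ⟩
  sumUpTo H n xor false                 ≡⟨ xor-identityʳ _ ⟩
  sumUpTo H n                           ∎
  where open ≡-Reasoning

sumUpTo-multiples : ∀ (H : ℕ → Bool) m k → (∀ i → ¬ (suc m ∣ i) → H i ≡ false) →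
  sumUpTo H (k * suc m) ≡ sumUpTo (λ i → H (i * suc m)) k
sumUpTo-multiples H m zero    _      = refl
sumUpTo-multiples H m (suc k) H≡false = cong (_xor H (suc k * suc m)) (begin
  sumUpTo H (m + k * suc m)             ≡⟨ cong (sumUpTo H) (+-comm m (k * suc m)) ⟩
  sumUpTo H (k * suc m + m)             ≡⟨ sumUpTo-extend-false H (k * suc m) m (λ t t<m → H≡false _ (∤ t t<m)) ⟩
  sumUpTo H (k * suc m)                 ≡⟨ sumUpTo-multiples H m k H≡false ⟩
  sumUpTo (λ i → H (i * suc m)) k       ∎)
  where
  open ≡-Reasoning
  ∤ : ∀ t → t < m → ¬ (suc m ∣ k * suc m + suc t)
  ∤ t t<m m∣ = <-irrefl refl (≤-trans (s≤s t<m) (∣⇒≤ (∣m+n∣m⇒∣n m∣ (n∣m*n k))))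

Palindromic : ℕ → (ℕ → Bool) → Set
Palindromic k H = ∀ i → i ≤ k → H i ≡ H (k ∸ i)

palindromic-inner : ∀ {m H} → Palindromic (suc (suc m)) H → Palindromic m (H ∘ suc)
palindromic-inner {m} {H} pal i i≤m = trans (pal (suc i) (s≤s (m≤n⇒m≤1+n i≤m))) (cong H (+-∸-assoc 1 i≤m))

sumUpTo-palindrome-peel : ∀ {m H} → Palindromic (suc (suc m)) H → sumUpTo H (suc (suc m)) ≡ sumUpTo (H ∘ suc) m
sumUpTo-palindrome-peel {m} {H} pal = begin
  sumUpTo H (suc (suc m))                               ≡⟨ sumUpTo-suc H (suc m) ⟩
  H 0 xor (sumUpTo (H ∘ suc) m xor H (suc (suc m)))
                                                        ≡⟨ cong (λ x → H 0 xor (sumUpTo (H ∘ suc) m xor x)) (pal 0 z≤n) ⟨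
  H 0 xor (sumUpTo (H ∘ suc) m xor H 0)                 ≡⟨ cong (H 0 xor_) (xor-comm _ (H 0)) ⟩
  H 0 xor (H 0 xor sumUpTo (H ∘ suc) m)                 ≡⟨ xor-cancelˡ (H 0) _ ⟩
  sumUpTo (H ∘ suc) m                                   ∎
  where open ≡-Reasoning

sumUpTo-palindrome-even : ∀ n H → Palindromic (twice n) H → sumUpTo H (twice n) ≡ H n
sumUpTo-palindrome-even zero    H pal = refl
sumUpTo-palindrome-even (suc n) H pal =
  trans (sumUpTo-palindrome-peel pal) (sumUpTo-palindrome-even n (H ∘ suc) (palindromic-inner pal))

sumUpTo-palindrome-odd : ∀ n H → Palindromic (suc (twice n)) H → sumUpTo H (suc (twice n)) ≡ false
sumUpTo-palindrome-odd zero    H pal = trans (cong (_xor H 1) (pal 0 z≤n)) (xor-same (H 1))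
sumUpTo-palindrome-odd (suc n) H pal =
  trans (sumUpTo-palindrome-peel pal) (sumUpTo-palindrome-odd n (H ∘ suc) (palindromic-inner pal))

-- The ring 𝔽₂[[t]]

infixl 6 _⊕_
_⊕_ : Series → Series → Series
(f ⊕ g) k = f k xor g k

AgreeUpTo : ℕ → Series → Series → Set
AgreeUpTo k f g = ∀ j → j ≤ k → f j ≡ g j

⊛-congˡ-upTo : ∀ {f g} h k → AgreeUpTo k f g → (f ⊛ h) k ≡ (g ⊛ h) k
⊛-congˡ-upTo h k f≈g = sumUpTo-cong k (λ i i≤k → cong (_∧ h (k ∸ i)) (f≈g i i≤k))

⊛-congʳ-upTo : ∀ {f g} h k → AgreeUpTo k f g → (h ⊛ f) k ≡ (h ⊛ g) k
⊛-congʳ-upTo h k f≈g = sumUpTo-cong k (λ i _ → cong (h i ∧_) (f≈g (k ∸ i) (m∸n≤m k i)))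

⊛-cong : ∀ {f f′ g g′} → f ≗ f′ → g ≗ g′ → f ⊛ g ≗ f′ ⊛ g′
⊛-cong {f′ = f′} {g = g} f≗f′ g≗g′ k =
  trans (⊛-congˡ-upTo g k (λ i _ → f≗f′ i)) (⊛-congʳ-upTo f′ k (λ i _ → g≗g′ i))

⊛-comm : ∀ f g → f ⊛ g ≗ g ⊛ f
⊛-comm f g k = trans (sumUpTo-reverse _ k) (sumUpTo-cong k λ i i≤k →
  trans (cong (λ n → f (k ∸ i) ∧ g n) (m∸[m∸n]≡n i≤k)) (∧-comm (f (k ∸ i)) (g i)))

⊛-assoc : ∀ f g h → (f ⊛ g) ⊛ h ≗ f ⊛ (g ⊛ h)
⊛-assoc f g h k = begin
  sumUpTo (λ i → sumUpTo (λ j → f j ∧ g (i ∸ j)) i ∧ h (k ∸ i)) k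
    ≡⟨ sumUpTo-cong k (λ i _ → sym (sumUpTo-∧ʳ (h (k ∸ i)) (λ j → f j ∧ g (i ∸ j)) i)) ⟩
  sumUpTo (λ i → sumUpTo (λ j → (f j ∧ g (i ∸ j)) ∧ h (k ∸ i)) i) k
    ≡⟨ sumUpTo-triangle (λ i j → (f j ∧ g (i ∸ j)) ∧ h (k ∸ i)) k ⟩
  sumUpTo (λ j → sumUpTo (λ l → (f j ∧ g (j + l ∸ j)) ∧ h (k ∸ (j + l))) (k ∸ j)) k
    ≡⟨ sumUpTo-cong k (λ j _ → trans (sumUpTo-cong (k ∸ j) (λ l _ → reassociate j l))
                                     (sumUpTo-∧ˡ (f j) (λ l → g l ∧ h (k ∸ j ∸ l)) (k ∸ j))) ⟩
  sumUpTo (λ j → f j ∧ sumUpTo (λ l → g l ∧ h (k ∸ j ∸ l)) (k ∸ j)) k ∎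
  where
  open ≡-Reasoning
  reassociate : ∀ j l → (f j ∧ g (j + l ∸ j)) ∧ h (k ∸ (j + l)) ≡ f j ∧ (g l ∧ h (k ∸ j ∸ l))
  reassociate j l rewrite m+n∸m≡n j l | ∸-+-assoc k j l = ∧-assoc (f j) (g l) _

⊛-distribˡ : ∀ f g h → f ⊛ (g ⊕ h) ≗ (f ⊛ g) ⊕ (f ⊛ h)
⊛-distribˡ f g h k =
  trans (sumUpTo-cong k (λ i _ → ∧-distribˡ-xor (f i) (g (k ∸ i)) (h (k ∸ i)))) (sumUpTo-xor _ _ k)

⊛-distribʳ : ∀ f g h → (g ⊕ h) ⊛ f ≗ (g ⊛ f) ⊕ (h ⊛ f)
⊛-distribʳ f g h k = trans (⊛-comm (g ⊕ h) f k)
  (trans (⊛-distribˡ f g h k) (cong₂ _xor_ (⊛-comm f g k) (⊛-comm f h k)))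

⊛-identityˡ : ∀ f → oneSeries ⊛ f ≗ f
⊛-identityˡ f zero    = refl
⊛-identityˡ f (suc k) = trans (sumUpTo-suc _ k)
  (trans (cong (f (suc k) xor_) (sumUpTo-false _ k (λ _ _ → refl))) (xor-identityʳ _))

⊛-identityʳ : ∀ f → f ⊛ oneSeries ≗ f
⊛-identityʳ f k = trans (⊛-comm f oneSeries k) (⊛-identityˡ f k)

monomial : ℕ → Series
monomial k j = does (j ≟ k)

monomial-self : ∀ k → monomial k k ≡ true
monomial-self k = dec-true (k ≟ k) refl

monomial-below : ∀ {k j} → j < k → monomial k j ≡ false
monomial-below {k} {j} j<k = dec-false (j ≟ k) (<⇒≢ j<k)

⊕-monomial-below : ∀ g {k j} → j < k → (g ⊕ monomial k) j ≡ g j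
⊕-monomial-below g {j = j} j<k = trans (cong (g j xor_) (monomial-below j<k)) (xor-identityʳ (g j))


⊛-leading : ∀ f g k → (∀ i → i < k → g i ≡ false) → (f ⊛ g) k ≡ f 0 ∧ g k
⊛-leading f g zero    _       = refl
⊛-leading f g (suc k) g<k≡0 = trans (sumUpTo-suc _ k) (trans
  (cong (f 0 ∧ g (suc k) xor_) (sumUpTo-false _ k (λ i _ →
     trans (cong (f (suc i) ∧_) (g<k≡0 (k ∸ i) (s≤s (m∸n≤m k i)))) (∧-zeroʳ (f (suc i))))))
  (xor-identityʳ _))

⊕-monomial-jump : ∀ g k → g k xor (g ⊕ monomial k) k ≡ true
⊕-monomial-jump g k = trans (xor-cancelˡ (g k) (monomial k k)) (monomial-self k)

⊕-monomial-self : ∀ g k → (g ⊕ monomial k) k ≡ not (g k)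
⊕-monomial-self g k = xor≡true⇒≡not (g k) _ (⊕-monomial-jump g k)

⊕-monomial-agrees : ∀ g k → AgreeUpTo k g (g ⊕ monomial (suc k))
⊕-monomial-agrees g k j j≤k = sym (⊕-monomial-below g (s≤s j≤k))

⊛-perturb : ∀ {f f′ g g′} k → AgreeUpTo k f f′ → AgreeUpTo k g g′ →
  (f ⊛ g) (suc k) xor (f′ ⊛ g′) (suc k) ≡
  ((f (suc k) xor f′ (suc k)) ∧ g 0) xor (f 0 ∧ (g (suc k) xor g′ (suc k)))
⊛-perturb {f} {f′} {g} {g′} k f≈f′ g≈g′ = begin
  (f ⊛ g) K xor (f′ ⊛ g′) K
    ≡⟨ cong ((f ⊛ g) K xor_) (⊛-cong (λ j → xor-cancelˡ (f j) (f′ j)) (λ j → xor-cancelˡ (g j) (g′ j)) K) ⟨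
  (f ⊛ g) K xor ((f ⊕ a) ⊛ (g ⊕ b)) K
    ≡⟨ cong ((f ⊛ g) K xor_) (trans (⊛-distribʳ (g ⊕ b) f a K)
         (cong₂ _xor_ (⊛-distribˡ f g b K) (⊛-distribˡ a g b K))) ⟩
  (f ⊛ g) K xor (((f ⊛ g) K xor (f ⊛ b) K) xor ((a ⊛ g) K xor (a ⊛ b) K))
    ≡⟨ cong₂ (λ x y → (f ⊛ g) K xor (((f ⊛ g) K xor x) xor y))
         (⊛-leading f b K b-below)
         (cong₂ _xor_ (trans (⊛-comm a g K) (⊛-leading g a K a-below)) (⊛-leading a b K b-below)) ⟩
  (f ⊛ g) K xor (((f ⊛ g) K xor (f 0 ∧ b K)) xor ((g 0 ∧ a K) xor (a 0 ∧ b K)))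
    ≡⟨ cong (λ x → (f ⊛ g) K xor (((f ⊛ g) K xor (f 0 ∧ b K)) xor x))
         (trans (cong (λ x → (g 0 ∧ a K) xor (x ∧ b K)) (a-below 0 (s≤s z≤n))) (xor-identityʳ _)) ⟩
  (f ⊛ g) K xor (((f ⊛ g) K xor (f 0 ∧ b K)) xor (g 0 ∧ a K))
    ≡⟨ cong ((f ⊛ g) K xor_) (xor-assoc ((f ⊛ g) K) _ _) ⟩
  (f ⊛ g) K xor ((f ⊛ g) K xor ((f 0 ∧ b K) xor (g 0 ∧ a K)))
    ≡⟨ xor-cancelˡ ((f ⊛ g) K) _ ⟩
  (f 0 ∧ b K) xor (g 0 ∧ a K)
    ≡⟨ trans (xor-comm (f 0 ∧ b K) _) (cong (_xor (f 0 ∧ b K)) (∧-comm (g 0) (a K))) ⟩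
  (a K ∧ g 0) xor (f 0 ∧ b K) ∎
  where
  open ≡-Reasoning
  K = suc k
  a b : Series
  a = f ⊕ f′
  b = g ⊕ g′
  vanishes : ∀ {h h′} → AgreeUpTo k h h′ → ∀ i → i < K → (h ⊕ h′) i ≡ false
  vanishes {h} {h′} h≈h′ i i<K = trans (cong (h i xor_) (sym (h≈h′ i (≤-pred i<K)))) (xor-same (h i))
  a-below = vanishes f≈f′
  b-below = vanishes g≈g′

-- Solving equations coefficient by coefficient

≤-suc-cases : ∀ {j k} → j ≤ suc k → j ≤ k ⊎ j ≡ suc k
≤-suc-cases j≤1+k with m≤n⇒m<n∨m≡n j≤1+k
... | inj₁ j<1+k = inj₁ (≤-pred j<1+k)
... | inj₂ j≡1+k = inj₂ j≡1+k

Causal : (Series → Series) → Set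
Causal Φ = ∀ {g h} k → AgreeUpTo k g h → Φ g k ≡ Φ h k

agreeUpTo-≤ : ∀ {j k f g} → j ≤ k → AgreeUpTo k f g → AgreeUpTo j f g
agreeUpTo-≤ j≤k f≈g i i≤j = f≈g i (≤-trans i≤j j≤k)

causal-upTo : ∀ {Φ k g h} → Causal Φ → AgreeUpTo k g h → AgreeUpTo k (Φ g) (Φ h)
causal-upTo causal g≈h j j≤k = causal j (agreeUpTo-≤ j≤k g≈h)

module CoefficientwiseSolution
  (Φ : Series → Series) (causal : Causal Φ)
  (flips : ∀ g → g 0 ≡ true → ∀ k → Φ (g ⊕ monomial (suc k)) (suc k) ≡ not (Φ g (suc k)))
  where

  module _ (u : Series) where

    correct : ℕ → Series → Series
    correct k g with Φ g (suc k) Bool.≟ u (suc k)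
    ... | yes _ = g
    ... | no  _ = g ⊕ monomial (suc k)

    correct-agrees : ∀ k g → AgreeUpTo k (correct k g) g
    correct-agrees k g j j≤k with Φ g (suc k) Bool.≟ u (suc k)
    ... | yes _ = refl
    ... | no  _ = ⊕-monomial-below g (s≤s j≤k)

    correct-solves : ∀ k g → g 0 ≡ true → Φ (correct k g) (suc k) ≡ u (suc k)
    correct-solves k g g₀ with Φ g (suc k) Bool.≟ u (suc k)
    ... | yes Φg≡u = Φg≡u
    ... | no  Φg≢u = trans (flips g g₀ k) (sym (¬-not (λ u≡Φg → Φg≢u (sym u≡Φg))))

    approx : ℕ → Series
    approx zero    = oneSeries
    approx (suc k) = correct k (approx k)

    approx-constant : ∀ k → approx k 0 ≡ true
    approx-constant zero    = refl
    approx-constant (suc k) = trans (correct-agrees k (approx k) 0 z≤n) (approx-constant k)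

    approx-stable : ∀ m k → AgreeUpTo k (approx (m + k)) (approx k)
    approx-stable zero    k j j≤k = refl
    approx-stable (suc m) k j j≤k =
      trans (correct-agrees (m + k) (approx (m + k)) j (≤-trans j≤k (m≤n+m k m))) (approx-stable m k j j≤k)

    solution : Series
    solution j = approx j j

    solution-agrees : ∀ k → AgreeUpTo k solution (approx k)
    solution-agrees k j j≤k =
      sym (trans (cong (λ l → approx l j) (sym (m∸n+n≡m j≤k))) (approx-stable (k ∸ j) j j ≤-refl))

    solution-constant : solution 0 ≡ true
    solution-constant = approx-constant 0

    module _ (base : Φ oneSeries 0 ≡ u 0) where

      approx-solves : ∀ k → AgreeUpTo k (Φ (approx k)) u
      approx-solves zero    zero z≤n = base
      approx-solves (suc k) j  j≤1+k with ≤-suc-cases j≤1+k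
      ... | inj₁ j≤k  = trans (causal j (agreeUpTo-≤ j≤k (correct-agrees k (approx k))))
                              (approx-solves k j j≤k)
      ... | inj₂ refl = correct-solves k (approx k) (approx-constant k)

      solution-solves : Φ solution ≗ u
      solution-solves k = trans (causal k (solution-agrees k)) (approx-solves k k ≤-refl)

  unique : ∀ g h → g 0 ≡ true → h 0 ≡ true → Φ g ≗ Φ h → g ≗ h
  unique g h g₀ h₀ Φg≗Φh k = agree k k ≤-refl
    where
    agree : ∀ k → AgreeUpTo k g h
    agree zero    zero z≤n = trans g₀ (sym h₀)
    agree (suc k) j  j≤1+k with ≤-suc-cases j≤1+k
    ... | inj₁ j≤k  = agree k j j≤k
    ... | inj₂ refl with g (suc k) Bool.≟ h (suc k)
    ...   | yes g≡h = g≡h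
    ...   | no  g≢h = contradiction (trans (Φg≗Φh (suc k)) (trans (causal (suc k) h≈flipped) (flips g g₀ k)))
                                    (not-¬ refl)
      where
      h≈flipped : AgreeUpTo (suc k) h (g ⊕ monomial (suc k))
      h≈flipped i i≤1+k with ≤-suc-cases i≤1+k
      ... | inj₁ i≤k  = trans (sym (agree k i i≤k)) (sym (⊕-monomial-below g (s≤s i≤k)))
      ... | inj₂ refl = trans (¬-not (λ h≡g → g≢h (sym h≡g))) (sym (⊕-monomial-self g (suc k)))

infixr 30 _^_
_^_ : Series → ℕ → Series
g ^ zero  = oneSeries
g ^ suc n = g ⊛ g ^ n

^-causal : ∀ n → Causal (_^ n)
^-causal zero    k g≈h = refl
^-causal (suc n) {g} {h} k g≈h =
  trans (⊛-congˡ-upTo (g ^ n) k g≈h) (⊛-congʳ-upTo h k (causal-upTo (^-causal n) g≈h))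

^-constant : ∀ {g} n → g 0 ≡ true → (g ^ n) 0 ≡ true
^-constant zero    g₀ = refl
^-constant (suc n) g₀ = cong₂ _∧_ g₀ (^-constant n g₀)

^-perturb : ∀ {g} → g 0 ≡ true → ∀ k n →
  (g ^ n) (suc k) xor ((g ⊕ monomial (suc k)) ^ n) (suc k) ≡ isOdd n
^-perturb {g} g₀ k zero    = xor-same true
^-perturb {g} g₀ k (suc n) = begin
  (g ^ suc n) K xor (g′ ^ suc n) K
    ≡⟨ ⊛-perturb k (⊕-monomial-agrees g k) (causal-upTo (^-causal n) (⊕-monomial-agrees g k)) ⟩
  ((g K xor g′ K) ∧ (g ^ n) 0) xor (g 0 ∧ ((g ^ n) K xor (g′ ^ n) K))
    ≡⟨ cong₂ (λ x y → (x ∧ y) xor (g 0 ∧ ((g ^ n) K xor (g′ ^ n) K))) (⊕-monomial-jump g K) (^-constant n g₀) ⟩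
  true xor (g 0 ∧ ((g ^ n) K xor (g′ ^ n) K))
    ≡⟨ cong₂ (λ x y → true xor (x ∧ y)) g₀ (^-perturb g₀ k n) ⟩
  isOdd (suc n) ∎
  where
  open ≡-Reasoning
  K = suc k
  g′ = g ⊕ monomial K

module OddRoot (o : ℕ) (odd-o : isOdd o ≡ true) =
  CoefficientwiseSolution (_^ o) (^-causal o)
    (λ g g₀ k → xor≡true⇒≡not _ _ (trans (^-perturb g₀ k o) odd-o))

⊛-flips : ∀ f → f 0 ≡ true → ∀ g → g 0 ≡ true → ∀ k →
  (f ⊛ (g ⊕ monomial (suc k))) (suc k) ≡ not ((f ⊛ g) (suc k))
⊛-flips f f₀ g _ k = xor≡true⇒≡not _ _ (begin
  (f ⊛ g) K xor (f ⊛ (g ⊕ monomial K)) K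
    ≡⟨ ⊛-perturb k (λ _ _ → refl) (⊕-monomial-agrees g k) ⟩
  ((f K xor f K) ∧ g 0) xor (f 0 ∧ (g K xor (g ⊕ monomial K) K))
    ≡⟨ cong₂ (λ x y → (x ∧ g 0) xor y) (xor-same (f K)) (cong₂ _∧_ f₀ (⊕-monomial-jump g K)) ⟩
  true ∎)
  where
  open ≡-Reasoning
  K = suc k

module Inverse (f : Series) (f₀ : f 0 ≡ true) =
  CoefficientwiseSolution (f ⊛_) (λ k → ⊛-congʳ-upTo f k) (⊛-flips f f₀)

spread-multiple : ∀ m f k → spread m f (k * suc m) ≡ f k
spread-multiple m f k with suc m ∣? (k * suc m)
... | yes _  = cong f (m*n/n≡m k (suc m))
... | no  ∤ = contradiction (n∣m*n k) ∤

spread-nonmultiple : ∀ m f {j} → ¬ (suc m ∣ j) → spread m f j ≡ false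
spread-nonmultiple m f {j} ∤ with suc m ∣? j
... | yes m∣j = contradiction m∣j ∤
... | no  _ = refl

spread-cong : ∀ m {f g} → f ≗ g → spread m f ≗ spread m g
spread-cong m f≗g j with suc m ∣? j
... | yes _ = f≗g _
... | no  _ = refl

spread-injective : ∀ m {f g} → spread m f ≗ spread m g → f ≗ g
spread-injective m {f} {g} eq k = trans (sym (spread-multiple m f k)) (trans (eq (k * suc m)) (spread-multiple m g k))

spread-one : ∀ m → spread m oneSeries ≗ oneSeries
spread-one m j with suc m ∣? j
... | yes (divides zero    refl) = refl
... | yes (divides (suc q) refl) = cong oneSeries (m*n/n≡m (suc q) (suc m))
... | no  ∤ = nonzero j ∤
  where
  nonzero : ∀ j → ¬ (suc m ∣ j) → false ≡ oneSeries j
  nonzero zero    ∤ = contradiction (divides 0 refl) ∤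
  nonzero (suc j) _ = refl

spread-spread : ∀ a b L h → suc L ≡ suc a * suc b → spread a (spread b h) ≗ spread L h
spread-spread a b L h L≡ab j with suc L ∣? j
... | yes (divides q refl) = begin
  spread a (spread b h) (q * suc L)           ≡⟨ cong (spread a (spread b h)) q[L]≡q[b][a] ⟩
  spread a (spread b h) (q * suc b * suc a)   ≡⟨ spread-multiple a (spread b h) (q * suc b) ⟩
  spread b h (q * suc b)                      ≡⟨ spread-multiple b h q ⟩
  h q                                         ≡⟨ cong h (m*n/n≡m q (suc L)) ⟨
  h (q * suc L / suc L)                       ∎
  where
  open ≡-Reasoning
  q[L]≡q[b][a] : q * suc L ≡ q * suc b * suc a
  q[L]≡q[b][a] = trans (cong (q *_) (trans L≡ab (*-comm (suc a) (suc b)))) (sym (*-assoc q (suc b) (suc a)))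
... | no ∤ = outer
  where
  inner : ∀ q → q * suc a ≡ j → spread b h q ≡ false
  inner q q[a]≡j = spread-nonmultiple b h λ where
    (divides r refl) → ∤ (divides r (trans (sym q[a]≡j)
      (trans (*-assoc r (suc b) (suc a)) (cong (r *_) (trans (*-comm (suc b) (suc a)) (sym L≡ab))))))
  outer : spread a (spread b h) j ≡ false
  outer with suc a ∣? j
  ... | no  _ = refl
  ... | yes (divides q refl) = trans (cong (spread b h) (m*n/n≡m q (suc a))) (inner q refl)

spread-comm : ∀ a b h → spread a (spread b h) ≗ spread b (spread a h)
spread-comm a b h j = trans (spread-spread a b (b + a * suc b) h refl j)
  (sym (spread-spread b a (b + a * suc b) h (*-comm (suc a) (suc b)) j))

spread-⊛ : ∀ m f g → spread m (f ⊛ g) ≗ spread m f ⊛ spread m g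
spread-⊛ m f g j with suc m ∣? j
... | yes (divides k refl) = begin
  (f ⊛ g) (k * suc m / suc m)
    ≡⟨ cong (f ⊛ g) (m*n/n≡m k (suc m)) ⟩
  (f ⊛ g) k
    ≡⟨ sumUpTo-cong k (λ i i≤k → cong₂ _∧_ (spread-multiple m f i)
         (trans (cong (spread m g) (sym (*-distribʳ-∸ (suc m) k i))) (spread-multiple m g (k ∸ i)))) ⟨
  sumUpTo (λ i → spread m f (i * suc m) ∧ spread m g (k * suc m ∸ i * suc m)) k
    ≡⟨ sumUpTo-multiples _ m k (λ i ∤ → cong (_∧ _) (spread-nonmultiple m f ∤)) ⟨
  (spread m f ⊛ spread m g) (k * suc m) ∎
  where open ≡-Reasoning
... | no ∤ = sym (sumUpTo-false _ j vanishes)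
  where
  vanishes : ∀ i → i ≤ j → spread m f i ∧ spread m g (j ∸ i) ≡ false
  vanishes i i≤j with suc m ∣? i
  ... | no  _   = refl
  ... | yes m∣i with suc m ∣? (j ∸ i)
  ...   | no  _     = ∧-zeroʳ _
  ...   | yes m∣j∸i = contradiction (subst (suc m ∣_) (m+[n∸m]≡n i≤j) (∣m∣n⇒∣m+n m∣i m∣j∸i)) ∤

⊛-self-palindromic : ∀ (f : Series) k → Palindromic k (λ i → f i ∧ f (k ∸ i))
⊛-self-palindromic f k i i≤k =
  trans (∧-comm (f i) (f (k ∸ i))) (cong (λ l → f (k ∸ i) ∧ f l) (sym (m∸[m∸n]≡n i≤k)))

⊛-self≗spread : ∀ f → f ⊛ f ≗ spread 1 f
⊛-self≗spread f j with evenOdd j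
... | even n = begin
  (f ⊛ f) (twice n)                  ≡⟨ sumUpTo-palindrome-even n _ (⊛-self-palindromic f (twice n)) ⟩
  f n ∧ f (twice n ∸ n)              ≡⟨ cong (λ k → f n ∧ f (k ∸ n)) (twice≡+ n) ⟩
  f n ∧ f (n + n ∸ n)                ≡⟨ cong (λ k → f n ∧ f k) (m+n∸m≡n n n) ⟩
  f n ∧ f n                          ≡⟨ ∧-idem (f n) ⟩
  f n                                ≡⟨ spread-multiple 1 f n ⟨
  spread 1 f (n * 2)                 ≡⟨ cong (spread 1 f) (twice≡*2 n) ⟨
  spread 1 f (twice n)               ∎
  where open ≡-Reasoning
... | odd n = trans (sumUpTo-palindrome-odd n _ (⊛-self-palindromic f (suc (twice n))))
                    (sym (spread-nonmultiple 1 f 2∤))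
  where
  2∤ : ¬ (2 ∣ suc (twice n))
  2∤ 2∣ = <-irrefl refl (∣⇒≤ (∣m+n∣m⇒∣n 2∣n*2+1 (n∣m*n n)))
    where 2∣n*2+1 = subst (2 ∣_) (trans (cong suc (twice≡*2 n)) (+-comm 1 (n * 2))) 2∣

^2≗spread : ∀ f → f ^ 2 ≗ spread 1 f
^2≗spread f j = trans (⊛-congʳ-upTo f j (λ i _ → ⊛-identityʳ f i)) (⊛-self≗spread f j)

-- The ring R

≈R-refl : ∀ {u} → u ≈R u
≈R-refl _ = refl

≈R-sym : ∀ {u v} → u ≈R v → v ≈R u
≈R-sym u≈v j = sym (u≈v j)

≈R-trans : ∀ {u v w} → u ≈R v → v ≈R w → u ≈R w
≈R-trans {⟨ d , f ⟩} {⟨ e , g ⟩} {⟨ c , h ⟩} u≈v v≈w = spread-injective e λ j → begin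
  spread e (spread c f) j  ≡⟨ spread-comm e c f j ⟩
  spread c (spread e f) j  ≡⟨ spread-cong c u≈v j ⟩
  spread c (spread d g) j  ≡⟨ spread-comm c d g j ⟩
  spread d (spread c g) j  ≡⟨ spread-cong d v≈w j ⟩
  spread d (spread e h) j  ≡⟨ spread-comm d e h j ⟩
  spread e (spread d h) j  ∎
  where open ≡-Reasoning

R-setoid : Setoid 0ℓ 0ℓ
R-setoid = record
  { Carrier = R ; _≈_ = _≈R_
  ; isEquivalence = record
    { refl = λ {u} → ≈R-refl {u} ; sym = λ {u} {v} → ≈R-sym {u} {v} ; trans = λ {u} {v} {w} → ≈R-trans {u} {v} {w} } }

module ≈R-Reasoning = SetoidReasoning R-setoid

≈R-level : ∀ c {F G} → F ≗ G → ⟨ c , F ⟩ ≈R ⟨ c , G ⟩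
≈R-level c F≗G = spread-cong c F≗G

≈R-level⁻¹ : ∀ c {F G} → ⟨ c , F ⟩ ≈R ⟨ c , G ⟩ → F ≗ G
≈R-level⁻¹ c = spread-injective c

refine : ∀ c m L h → suc L ≡ suc c * suc m → ⟨ c , h ⟩ ≈R ⟨ L , spread m h ⟩
refine c m L h L≡cm j = sym (spread-spread c m L h L≡cm j)

·R-at-level : ∀ u v c F G → u ≈R ⟨ c , F ⟩ → v ≈R ⟨ c , G ⟩ → (u ·R v) ≈R ⟨ c , F ⊛ G ⟩
·R-at-level ⟨ d , f ⟩ ⟨ e , g ⟩ c F G u≈F v≈G j = begin
  spread c (spread e f ⊛ spread d g) j            ≡⟨ spread-⊛ c (spread e f) (spread d g) j ⟩
  (spread c (spread e f) ⊛ spread c (spread d g)) j ≡⟨ ⊛-cong f-at-L g-at-L j ⟩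
  (spread L F ⊛ spread L G) j                     ≡⟨ spread-⊛ L F G j ⟨
  spread L (F ⊛ G) j                              ∎
  where
  open ≡-Reasoning
  L = e + d * suc e
  f-at-L : spread c (spread e f) ≗ spread L F
  f-at-L i = trans (spread-comm c e f i) (trans (spread-cong e u≈F i) (spread-spread e d L F (*-comm (suc d) (suc e)) i))
  g-at-L : spread c (spread d g) ≗ spread L G
  g-at-L i = trans (spread-comm c d g i) (trans (spread-cong d v≈G i) (spread-spread d e L G refl i))

commonˡ : ∀ u v → u ≈R ⟨ den-1 (u ·R v) , spread (den-1 v) (ser u) ⟩
commonˡ ⟨ d , f ⟩ ⟨ e , g ⟩ = refine d e _ f refl

commonʳ : ∀ u v → v ≈R ⟨ den-1 (u ·R v) , spread (den-1 u) (ser v) ⟩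
commonʳ ⟨ d , f ⟩ ⟨ e , g ⟩ = refine e d _ g (*-comm (suc d) (suc e))

·R-cong : ∀ u u′ v v′ → u ≈R u′ → v ≈R v′ → (u ·R v) ≈R (u′ ·R v′)
·R-cong u u′ v v′ u≈u′ v≈v′ = begin
  u ·R v          ≈⟨ ·R-at-level u v L F G (commonˡ u v) (commonʳ u v) ⟩
  ⟨ L , F ⊛ G ⟩   ≈⟨ ·R-at-level u′ v′ L F G u′≈F v′≈G ⟨
  u′ ·R v′        ∎
  where
  open ≈R-Reasoning
  L = den-1 (u ·R v)
  F = spread (den-1 v) (ser u)
  G = spread (den-1 u) (ser v)
  u′≈F : u′ ≈R ⟨ L , F ⟩
  u′≈F = begin u′ ≈⟨ u≈u′ ⟨ u ≈⟨ commonˡ u v ⟩ ⟨ L , F ⟩ ∎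
  v′≈G : v′ ≈R ⟨ L , G ⟩
  v′≈G = begin v′ ≈⟨ v≈v′ ⟨ v ≈⟨ commonʳ u v ⟩ ⟨ L , G ⟩ ∎

·R-comm : ∀ u v → (u ·R v) ≈R (v ·R u)
·R-comm u v = begin
  u ·R v         ≈⟨ ·R-at-level u v L F G (commonˡ u v) (commonʳ u v) ⟩
  ⟨ L , F ⊛ G ⟩  ≈⟨ ≈R-level L (⊛-comm F G) ⟩
  ⟨ L , G ⊛ F ⟩  ≈⟨ ·R-at-level v u L G F (commonʳ u v) (commonˡ u v) ⟨
  v ·R u         ∎
  where
  open ≈R-Reasoning
  L = den-1 (u ·R v)
  F = spread (den-1 v) (ser u)
  G = spread (den-1 u) (ser v)

·R-assoc : ∀ u v w → ((u ·R v) ·R w) ≈R (u ·R (v ·R w))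
·R-assoc u@(⟨ d , f ⟩) v@(⟨ e , g ⟩) w@(⟨ c , h ⟩) = begin
  (u ·R v) ·R w          ≈⟨ ·R-at-level (u ·R v) w M (F ⊛ G) H (·R-at-level u v M F G u≈F v≈G) w≈H ⟩
  ⟨ M , (F ⊛ G) ⊛ H ⟩    ≈⟨ ≈R-level M (⊛-assoc F G H) ⟩
  ⟨ M , F ⊛ (G ⊛ H) ⟩    ≈⟨ ·R-at-level u (v ·R w) M F (G ⊛ H) u≈F (·R-at-level v w M G H v≈G w≈H) ⟨
  u ·R (v ·R w)          ∎
  where
  open ≈R-Reasoning
  L = e + d * suc e
  M = c + L * suc c
  F = spread c (spread e f)
  G = spread c (spread d g)
  H = spread L h
  u≈F : u ≈R ⟨ M , F ⟩
  u≈F = begin u ≈⟨ refine d e L f refl ⟩ ⟨ L , spread e f ⟩ ≈⟨ refine L c M (spread e f) refl ⟩ ⟨ M , F ⟩ ∎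
  v≈G : v ≈R ⟨ M , G ⟩
  v≈G = begin
    v                    ≈⟨ refine e d L g (*-comm (suc d) (suc e)) ⟩
    ⟨ L , spread d g ⟩   ≈⟨ refine L c M (spread d g) refl ⟩
    ⟨ M , G ⟩            ∎
  w≈H : w ≈R ⟨ M , H ⟩
  w≈H = refine c L M h (*-comm (suc L) (suc c))

1R-at-level : ∀ c → 1R ≈R ⟨ c , oneSeries ⟩
1R-at-level c = begin
  1R                             ≈⟨ refine 0 c c oneSeries (sym (+-identityʳ (suc c))) ⟩
  ⟨ c , spread c oneSeries ⟩     ≈⟨ ≈R-level c (spread-one c) ⟩
  ⟨ c , oneSeries ⟩              ∎
  where open ≈R-Reasoning

·R-identityˡ : ∀ u → (1R ·R u) ≈R u
·R-identityˡ u@(⟨ d , f ⟩) = begin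
  1R ·R u                    ≈⟨ ·R-at-level 1R u d oneSeries f (1R-at-level d) (≈R-refl {u}) ⟩
  ⟨ d , oneSeries ⊛ f ⟩      ≈⟨ ≈R-level d (⊛-identityˡ f) ⟩
  u                          ∎
  where open ≈R-Reasoning

-- The unit group of R

ConstantOne : R → Set
ConstantOne u = ser u 0 ≡ true

≈R-constant : ∀ u v → u ≈R v → ser u 0 ≡ ser v 0
≈R-constant u v u≈v = u≈v 0

inverse : (u : R) → ConstantOne u → R
inverse ⟨ d , f ⟩ f₀ = ⟨ d , Inverse.solution f f₀ oneSeries ⟩

inverse-constantOne : ∀ u u₀ → ConstantOne (inverse u u₀)
inverse-constantOne ⟨ d , f ⟩ f₀ = Inverse.solution-constant f f₀ oneSeries

·R-inverseʳ : ∀ u u₀ → (u ·R inverse u u₀) ≈R 1R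
·R-inverseʳ u@(⟨ d , f ⟩) f₀ = begin
  u ·R inverse u f₀         ≈⟨ ·R-at-level u (inverse u f₀) d f g (≈R-refl {u}) (≈R-refl {inverse u f₀}) ⟩
  ⟨ d , f ⊛ g ⟩             ≈⟨ ≈R-level d (Inverse.solution-solves f f₀ oneSeries (cong (_∧ true) f₀)) ⟩
  ⟨ d , oneSeries ⟩         ≈⟨ 1R-at-level d ⟨
  1R                        ∎
  where
  open ≈R-Reasoning
  g = Inverse.solution f f₀ oneSeries

·R-identityʳ : ∀ u → (u ·R 1R) ≈R u
·R-identityʳ u = ≈R-trans {u ·R 1R} {1R ·R u} {u} (·R-comm u 1R) (·R-identityˡ u)

·R-inverseˡ : ∀ u u₀ → (inverse u u₀ ·R u) ≈R 1R
·R-inverseˡ u u₀ =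
  ≈R-trans {inverse u u₀ ·R u} {u ·R inverse u u₀} {1R} (·R-comm (inverse u u₀) u) (·R-inverseʳ u u₀)

inverse-cong : ∀ u u₀ v v₀ → u ≈R v → inverse u u₀ ≈R inverse v v₀
inverse-cong u u₀ v v₀ u≈v = begin
  u′                  ≈⟨ ·R-identityˡ u′ ⟨
  1R ·R u′            ≈⟨ ·R-cong 1R (v′ ·R v) u′ u′ (≈R-sym {v′ ·R v} {1R} (·R-inverseˡ v v₀)) (≈R-refl {u′}) ⟩
  (v′ ·R v) ·R u′     ≈⟨ ·R-cong (v′ ·R v) (v′ ·R u) u′ u′
                           (·R-cong v′ v′ v u (≈R-refl {v′}) (≈R-sym {u} {v} u≈v)) (≈R-refl {u′}) ⟩
  (v′ ·R u) ·R u′     ≈⟨ ·R-assoc v′ u u′ ⟩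
  v′ ·R (u ·R u′)     ≈⟨ ·R-cong v′ v′ (u ·R u′) 1R (≈R-refl {v′}) (·R-inverseʳ u u₀) ⟩
  v′ ·R 1R            ≈⟨ ·R-identityʳ v′ ⟩
  v′                  ∎
  where
  open ≈R-Reasoning
  u′ = inverse u u₀
  v′ = inverse v v₀

isUnitR⇔constantOne : ∀ u → IsUnitR u ⇔ ConstantOne u
isUnitR⇔constantOne u = mk⇔
  (λ (v , uv≈1 , _) → ∧-conicalˡ (ser u 0) (ser v 0) (≈R-constant (u ·R v) 1R uv≈1))
  (λ u₀ → inverse u u₀ , ·R-inverseʳ u u₀ , ·R-inverseˡ u u₀)

isUnitAtLevel⇔constantOne : ∀ d f → IsUnitAtLevel d f ⇔ ConstantOne ⟨ d , f ⟩
isUnitAtLevel⇔constantOne d f = mk⇔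
  (λ (g , fg≗1 , _) → ∧-conicalˡ (f 0) (g 0) (fg≗1 0))
  (λ f₀ → let g = Inverse.solution f f₀ oneSeries
              fg≗1 = Inverse.solution-solves f f₀ oneSeries (cong (_∧ true) f₀)
          in g , fg≗1 , λ k → trans (⊛-comm g f k) (fg≗1 k))

Unit : Set
Unit = Σ R ConstantOne

infix 4 _≈U_
_≈U_ : Unit → Unit → Set
a ≈U b = proj₁ a ≈R proj₁ b

infixl 7 _·U_
_·U_ : Unit → Unit → Unit
(u , u₀) ·U (v , v₀) = u ·R v , cong₂ _∧_ u₀ v₀

1U : Unit
1U = 1R , refl

_⁻¹U : Unit → Unit
(u , u₀) ⁻¹U = inverse u u₀ , inverse-constantOne u u₀

unitGroup : AbelianGroup 0ℓ 0ℓ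
unitGroup = record
  { Carrier = Unit ; _≈_ = _≈U_ ; _∙_ = _·U_ ; ε = 1U ; _⁻¹ = _⁻¹U
  ; isAbelianGroup = record
    { isGroup = record
      { isMonoid = record
        { isSemigroup = record
          { isMagma = record
            { isEquivalence = record
              { refl  = λ {a} → ≈R-refl {proj₁ a}
              ; sym   = λ {a} {b} → ≈R-sym {proj₁ a} {proj₁ b}
              ; trans = λ {a} {b} {c} → ≈R-trans {proj₁ a} {proj₁ b} {proj₁ c} }
            ; ∙-cong = λ {a} {a′} {b} {b′} → ·R-cong (proj₁ a) (proj₁ a′) (proj₁ b) (proj₁ b′) }
          ; assoc = λ a b c → ·R-assoc (proj₁ a) (proj₁ b) (proj₁ c) }
        ; identity = (λ a → ·R-identityˡ (proj₁ a)) , (λ a → ·R-identityʳ (proj₁ a)) }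
      ; inverse = (λ (u , u₀) → ·R-inverseˡ u u₀) , (λ (u , u₀) → ·R-inverseʳ u u₀)
      ; ⁻¹-cong = λ {(u , u₀)} {(v , v₀)} → inverse-cong u u₀ v v₀ }
    ; comm = λ a b → ·R-comm (proj₁ a) (proj₁ b) } }

module UnitGroup = DivisibleAbelianGroup unitGroup
open UnitGroup using (UniquelyDivisibleBy; PowInjective) renaming (_^_ to _^U_)

^U-at-level : ∀ n a c F → proj₁ a ≈R ⟨ c , F ⟩ → proj₁ (a ^U n) ≈R ⟨ c , F ^ n ⟩
^U-at-level zero    a c F _   = 1R-at-level c
^U-at-level (suc n) a c F a≈F =
  ·R-at-level (proj₁ a) (proj₁ (a ^U n)) c F (F ^ n) a≈F (^U-at-level n a c F a≈F)

powInjective-levelwise : ∀ n → (∀ F G → F 0 ≡ true → G 0 ≡ true → F ^ n ≗ G ^ n → F ≗ G) → PowInjective n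
powInjective-levelwise n inj a@(u , u₀) b@(v , v₀) a^n≈b^n = begin
  u            ≈⟨ commonˡ u v ⟩
  ⟨ L , F ⟩    ≈⟨ ≈R-level L (inj F G u₀ v₀ (≈R-level⁻¹ L F^n≈G^n)) ⟩
  ⟨ L , G ⟩    ≈⟨ commonʳ u v ⟨
  v            ∎
  where
  open ≈R-Reasoning
  L = den-1 (u ·R v)
  F = spread (den-1 v) (ser u)
  G = spread (den-1 u) (ser v)
  F^n≈G^n : ⟨ L , F ^ n ⟩ ≈R ⟨ L , G ^ n ⟩
  F^n≈G^n = begin
    ⟨ L , F ^ n ⟩      ≈⟨ ^U-at-level n a L F (commonˡ u v) ⟨
    proj₁ (a ^U n)     ≈⟨ a^n≈b^n ⟩
    proj₁ (b ^U n)     ≈⟨ ^U-at-level n b L G (commonʳ u v) ⟩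
    ⟨ L , G ^ n ⟩      ∎

-- The same coefficients, read as a series in x^{1/2(d+1)}.
squareRoot : Unit → Unit
squareRoot (⟨ d , f ⟩ , f₀) = ⟨ suc (d * 2) , f ⟩ , f₀

squareRoot-spec : ∀ a → squareRoot a ^U 2 ≈U a
squareRoot-spec a@(⟨ d , f ⟩ , f₀) = begin
  proj₁ (squareRoot a ^U 2)  ≈⟨ ^U-at-level 2 (squareRoot a) L f (≈R-refl {proj₁ (squareRoot a)}) ⟩
  ⟨ L , f ^ 2 ⟩              ≈⟨ ≈R-level L (^2≗spread f) ⟩
  ⟨ L , spread 1 f ⟩         ≈⟨ refine d 1 L f refl ⟨
  ⟨ d , f ⟩                  ∎
  where
  open ≈R-Reasoning
  L = suc (d * 2)

unitGroup-divisibleBy-2 : UniquelyDivisibleBy 2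
unitGroup-divisibleBy-2 = (λ a → squareRoot a , squareRoot-spec a) , powInjective-levelwise 2
  λ F G _ _ F²≗G² → spread-injective 1 λ j → trans (sym (^2≗spread F j)) (trans (F²≗G² j) (^2≗spread G j))

module _ (n : ℕ) where

  private
    o = suc (twice n)
    open OddRoot o (isOdd-1+twice n)

  oddRoot : Unit → Unit
  oddRoot (⟨ d , f ⟩ , _) = ⟨ d , solution f ⟩ , solution-constant f

  oddRoot-spec : ∀ a → oddRoot a ^U o ≈U a
  oddRoot-spec a@(⟨ d , f ⟩ , f₀) = begin
    proj₁ (oddRoot a ^U o)    ≈⟨ ^U-at-level o (oddRoot a) d (solution f) (≈R-refl {proj₁ (oddRoot a)}) ⟩
    ⟨ d , solution f ^ o ⟩    ≈⟨ ≈R-level d (solution-solves f (trans (^-constant {oneSeries} o refl) (sym f₀))) ⟩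
    ⟨ d , f ⟩                 ∎
    where open ≈R-Reasoning

  unitGroup-divisibleBy-odd : UniquelyDivisibleBy o
  unitGroup-divisibleBy-odd = (λ a → oddRoot a , oddRoot-spec a) , powInjective-levelwise o unique

unitGroup-uniquelyDivisible : ∀ n → UniquelyDivisibleBy (suc n)
unitGroup-uniquelyDivisible = UnitGroup.uniquelyDivisible unitGroup-divisibleBy-2 unitGroup-divisibleBy-odd

open UnitGroup.ScalarAction unitGroup-uniquelyDivisible
  using () renaming (_•_ to _•U_; •-cong to •U-cong; •-identity to •U-identity; •-assoc to •U-assoc;
                     •-distribʳ to •U-distribʳ; •-distribˡ to •U-distribˡ)

-- Non-units are sent to 1; the axioms only concern units, so this value is never used.
toUnit : R → Unit
toUnit u with ser u 0 Bool.≟ true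
... | yes u₀ = u , u₀
... | no  _  = 1U

toUnit-≈ : ∀ u (u₀ : ConstantOne u) → toUnit u ≈U (u , u₀)
toUnit-≈ u u₀ with ser u 0 Bool.≟ true
... | yes _  = ≈R-refl {u}
... | no  ¬u₀ = contradiction u₀ ¬u₀

module ≈U-Reasoning = SetoidReasoning (AbelianGroup.setoid unitGroup)

toUnit-·R : ∀ u v (u₀ : ConstantOne u) (v₀ : ConstantOne v) → toUnit (u ·R v) ≈U toUnit u ·U toUnit v
toUnit-·R u v u₀ v₀ = begin
  toUnit (u ·R v)          ≈⟨ toUnit-≈ (u ·R v) (cong₂ _∧_ u₀ v₀) ⟩
  (u , u₀) ·U (v , v₀)     ≈⟨ ·R-cong (toUnit u .proj₁) u (toUnit v .proj₁) v (toUnit-≈ u u₀) (toUnit-≈ v v₀) ⟨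
  toUnit u ·U toUnit v     ∎
  where open ≈U-Reasoning

constantOne : ∀ u → IsUnitR u → ConstantOne u
constantOne u = Equivalence.to (isUnitR⇔constantOne u)

_•_ : ℚ → R → R
q • u = proj₁ (q •U toUnit u)

isLinearSpaceOverℚ : IsLinearSpaceOverℚ _•_
isLinearSpaceOverℚ = record
  { •-closed   = λ q u _ → Equivalence.from (isUnitR⇔constantOne (q • u)) (proj₂ (q •U toUnit u))
  ; •-cong     = λ q u v u∈ v∈ u≈v → •U-cong q (begin
                   toUnit u                 ≈⟨ toUnit-≈ u (constantOne u u∈) ⟩
                   (u , constantOne u u∈)   ≈⟨ u≈v ⟩
                   (v , constantOne v v∈)   ≈⟨ toUnit-≈ v (constantOne v v∈) ⟨
                   toUnit v                 ∎)
  ; •-one      = λ u u∈ → begin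
                   1ℚ •U toUnit u           ≈⟨ •U-identity (toUnit u) ⟩
                   toUnit u                 ≈⟨ toUnit-≈ u (constantOne u u∈) ⟩
                   (u , constantOne u u∈)   ∎
  ; •-assoc    = λ p q u _ → let a = toUnit u in begin
                   (p ℚ.* q) •U a           ≈⟨ •U-assoc p q a ⟩
                   p •U (q •U a)            ≈⟨ •U-cong p (toUnit-≈ (q • u) (proj₂ (q •U a))) ⟨
                   p •U toUnit (q • u)      ∎
  ; •-distribʳ = λ p q u _ → •U-distribʳ p q (toUnit u)
  ; •-distribˡ = λ p u v u∈ v∈ → begin
                   p •U toUnit (u ·R v)
                     ≈⟨ •U-cong p (toUnit-·R u v (constantOne u u∈) (constantOne v v∈)) ⟩
                   p •U (toUnit u ·U toUnit v)      ≈⟨ •U-distribˡ p (toUnit u) (toUnit v) ⟩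
                   p •U toUnit u ·U p •U toUnit v   ∎
  }
  where open ≈U-Reasoning

lemma4p2 : ((u : R) → IsUnitR u ⇔ IsUnitAtLevel (den-1 u) (ser u))
    × UnitGroupIsLinearSpaceOverℚ
lemma4p2 = (λ u → ⇔-sym (isUnitAtLevel⇔constantOne (den-1 u) (ser u)) ⇔-∘ isUnitR⇔constantOne u)
         , _•_ , isLinearSpaceOverℚ
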